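{- Let $n\ge3$ be an integer and $P_n$ the path graph with $n$ vertices. Then \[\Upsilon(P_n)=\begin{cases}\{1,2\} & \text{if } n\in\{3,4\};\\ [n-3] & \text{if } n\ge5.\end{cases}\]
   Context: All graphs are finite and simple. For a positive integer $p$ and a digraph $D=(V,A)$ with $A\subseteq V\times V$ (loops allowed), the $p$-competition graph $C_p(D)$ has vertex set $V$, and distinct $x,y$ are adjacent iff there are $p$ distinct vertices $a_1,\dots,a_p\in V$ with $(x,a_i),(y,a_i)\in A$ for all $i$. A graph is a $p$-competition graph if it equals $C_p(D)$ for some digraph $D$. For a graph $G$ with $n$ vertices, $[n]=\{1,\dots,n\}$ and $\Upsilon(G)=\{p\in[n]\mid G\text{ is a }p\text{ -competition graph}\}$. -}

module Defs where

open import Data.Nat using (ℕ; zero; suc; _≤_; _∸_)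
open import Data.Fin using (Fin; toℕ)
open import Data.Product using (Σ; _×_; ∃)
open import Data.Sum using (_⊎_)
open import Relation.Nullary using (¬_)
open import Relation.Binary.PropositionalEquality using (_≡_; _≢_)
open import Function.Definitions using (Injective)
open import Function.Bundles using (_⇔_)

Graph : ℕ → Set₁
Graph n = Fin n → Fin n → Set

-- A digraph on vertex set Fin n (loops allowed), given by its arc relation.
Digraph : ℕ → Set₁
Digraph n = Fin n → Fin n → Set

Path : (n : ℕ) → Graph n
Path n x y = (toℕ y ≡ suc (toℕ x)) ⊎ (toℕ x ≡ suc (toℕ y))

CompAdj : {n : ℕ} → ℕ → Digraph n → Fin n → Fin n → Set
CompAdj {n} p D x y =
  Σ (Fin p → Fin n) λ a → Injective _≡_ _≡_ a × (∀ i → D x (a i) × D y (a i))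

IsCompGraphOf : {n : ℕ} → ℕ → Graph n → Digraph n → Set
IsCompGraphOf {n} p G D =
  (∀ x → ¬ G x x) × (∀ x y → x ≢ y → (G x y ⇔ CompAdj p D x y))

IsCompGraph : {n : ℕ} → ℕ → Graph n → Set₁
IsCompGraph {n} p G = Σ (Digraph n) λ D → IsCompGraphOf p G D

InUpsilon : {n : ℕ} → Graph n → ℕ → Set₁
InUpsilon {n} G p = (1 ≤ p × p ≤ n) × IsCompGraph p G

-- If distinct x, y are non-adjacent in C_p(D), and A, B are sets of out-neighbours
-- of x and y respectively, then |A ∩ B| < p, i.e. |A| + |B| < p + |A ∪ B|. Each edge i(i+1) of
-- P_n comes with a set E_i of p common out-neighbours. Taking x = 0, y = 2 gives |E₀ ∪ E₁| > p;
-- then E₀ ∪ E₁ and E₂ ∪ E₃ are out-neighbours of 1 and 3, so 2(p + 1) < p + n, i.e. p ≤ n − 3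
-- (for n = 3 already |E₀ ∪ E₁| ≤ 3 gives p ≤ 2, and for n = 4 so does E₂ in place of E₂ ∪ E₃). For p ≤ n − 3 every vertex points to itself and the next p vertices around the
-- cycle Z_n. Consecutive vertices share p of them; for vertices at distance d ≥ 2 the offsets of
-- the common out-neighbours, rotated by d, fall into {0, …, p − 2}. The cases n ∈ {3, 4}, p ≤ 2
-- are checked by computation, with interval out-neighbourhoods.

module Submission where

open import Defs
open import Data.Bool.Base using (_∧_)
open import Data.Empty using (⊥-elim)
open import Data.Fin using (Fin; zero; suc; toℕ; fromℕ<; inject≤; #_)
open import Data.Fin.Properties
  using (toℕ-injective; toℕ<n; toℕ-fromℕ<; injective⇒≤; inject≤-injective; all?)
  renaming (_≟_ to _≟ᶠ_; suc-injective to Fin-suc-injective)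
open import Data.Fin.Subset using (Subset; inside; outside; _∈_; _∉_; _∪_; _∩_; ⁅_⁆; ∣_∣; ⊥; Lift)
open import Data.Fin.Subset.Properties
  using ( ∣p∣≤n; p⊆q⇒∣p∣≤∣q∣; x∈p∩q⁺; x∈p∩q⁻; x∈p∪q⁻; x∈⁅y⁆⇒x≡y; ∣⁅x⁆∣≡1; ∣⊥∣≡0
        ; Empty-unique; ∉⊥)
open import Data.Nat
  using (ℕ; zero; suc; pred; _+_; _≤_; _<_; _∸_; z≤n; s≤s; _≤?_; _<?_; _≟_; _≤ᵇ_; _<ᵇ_; >-nonZero)
open import Data.Nat.Properties
open import Data.Product using (Σ; ∃; _×_; _,_; proj₁; proj₂)
open import Data.Sum using (_⊎_; [_,_]′; inj₁; inj₂)
open import Data.Vec.Base using ([]; _∷_; here; there; tabulate)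
open import Function.Base using (_∘_)
open import Function.Bundles using (Equivalence; _⇔_; mk⇔)
open import Function.Construct.Composition using (_⇔-∘_)
open import Function.Construct.Symmetry using (⇔-sym)
open import Function.Definitions using (Injective)
open import Relation.Binary.Definitions using (tri<; tri≈; tri>)
open import Relation.Binary.PropositionalEquality
open import Relation.Nullary using (¬_; yes; no; contradiction)
open import Relation.Nullary.Decidable using (Dec; True; ¬?; _×-dec_; _⊎-dec_; _→-dec_; map′; toWitness)

private variable n p : ℕ

∣p∪q∣+∣p∩q∣≡∣p∣+∣q∣ : (P Q : Subset n) → ∣ P ∪ Q ∣ + ∣ P ∩ Q ∣ ≡ ∣ P ∣ + ∣ Q ∣
∣p∪q∣+∣p∩q∣≡∣p∣+∣q∣ []            []            = refl
∣p∪q∣+∣p∩q∣≡∣p∣+∣q∣ (inside ∷ P)  (inside ∷ Q)  =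
  cong suc (trans (+-suc _ _) (trans (cong suc (∣p∪q∣+∣p∩q∣≡∣p∣+∣q∣ P Q)) (sym (+-suc _ _))))
∣p∪q∣+∣p∩q∣≡∣p∣+∣q∣ (inside ∷ P)  (outside ∷ Q) = cong suc (∣p∪q∣+∣p∩q∣≡∣p∣+∣q∣ P Q)
∣p∪q∣+∣p∩q∣≡∣p∣+∣q∣ (outside ∷ P) (inside ∷ Q)  =
  trans (cong suc (∣p∪q∣+∣p∩q∣≡∣p∣+∣q∣ P Q)) (sym (+-suc _ _))
∣p∪q∣+∣p∩q∣≡∣p∣+∣q∣ (outside ∷ P) (outside ∷ Q) = ∣p∪q∣+∣p∩q∣≡∣p∣+∣q∣ P Q

∣⁅x⁆∪p∣≡1+∣p∣ : {x : Fin n} {P : Subset n} → x ∉ P → ∣ ⁅ x ⁆ ∪ P ∣ ≡ suc ∣ P ∣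
∣⁅x⁆∪p∣≡1+∣p∣ {n} {x} {P} x∉P = begin
  ∣ ⁅ x ⁆ ∪ P ∣                   ≡⟨ sym (+-identityʳ _) ⟩
  ∣ ⁅ x ⁆ ∪ P ∣ + 0               ≡⟨ cong (λ k → ∣ ⁅ x ⁆ ∪ P ∣ + k) (sym ∣⁅x⁆∩p∣≡0) ⟩
  ∣ ⁅ x ⁆ ∪ P ∣ + ∣ ⁅ x ⁆ ∩ P ∣   ≡⟨ ∣p∪q∣+∣p∩q∣≡∣p∣+∣q∣ ⁅ x ⁆ P ⟩
  ∣ ⁅ x ⁆ ∣ + ∣ P ∣               ≡⟨ cong (_+ ∣ P ∣) (∣⁅x⁆∣≡1 x) ⟩
  suc ∣ P ∣                       ∎
  where
  open ≡-Reasoning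
  ∣⁅x⁆∩p∣≡0 : ∣ ⁅ x ⁆ ∩ P ∣ ≡ 0
  ∣⁅x⁆∩p∣≡0 = trans (cong ∣_∣ (Empty-unique λ (z , z∈) →
    let z∈⁅x⁆ , z∈P = x∈p∩q⁻ ⁅ x ⁆ P z∈ in x∉P (subst (_∈ P) (x∈⁅y⁆⇒x≡y x z∈⁅x⁆) z∈P))) (∣⊥∣≡0 n)

Lift-∪ : {A : Fin n → Set} {P Q : Subset n} → Lift A P → Lift A Q → Lift A (P ∪ Q)
Lift-∪ {P = P} {Q} AP AQ z∈ = [ AP , AQ ]′ (x∈p∪q⁻ P Q z∈)

image : (Fin p → Fin n) → Subset n
image {zero}  f = ⊥
image {suc p} f = ⁅ f zero ⁆ ∪ image (f ∘ suc)

∈-image⁻ : (f : Fin p → Fin n) {z : Fin n} → z ∈ image f → ∃ λ i → f i ≡ z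
∈-image⁻ {zero}  f z∈ = contradiction z∈ ∉⊥
∈-image⁻ {suc p} f z∈ with x∈p∪q⁻ ⁅ f zero ⁆ (image (f ∘ suc)) z∈
... | inj₁ z∈⁅f0⁆ = zero , sym (x∈⁅y⁆⇒x≡y (f zero) z∈⁅f0⁆)
... | inj₂ z∈im   = let i , fi≡z = ∈-image⁻ (f ∘ suc) z∈im in suc i , fi≡z

∣image∣≡ : {f : Fin p → Fin n} → Injective _≡_ _≡_ f → ∣ image f ∣ ≡ p
∣image∣≡ {zero}  {n} _ = ∣⊥∣≡0 n
∣image∣≡ {suc p} {f = f} f-inj =
  trans (∣⁅x⁆∪p∣≡1+∣p∣ f0∉) (cong suc (∣image∣≡ (λ e → Fin-suc-injective (f-inj e))))
  where
  f0∉ : f zero ∉ image (f ∘ suc)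
  f0∉ f0∈ with ∈-image⁻ (f ∘ suc) f0∈
  ... | i , fi≡f0 with f-inj fi≡f0
  ...   | ()

enumerate : (P : Subset n) → Fin ∣ P ∣ → Fin n
enumerate (inside ∷ P)  zero    = zero
enumerate (inside ∷ P)  (suc i) = suc (enumerate P i)
enumerate (outside ∷ P) i       = suc (enumerate P i)

enumerate-injective : (P : Subset n) → Injective _≡_ _≡_ (enumerate P)
enumerate-injective (inside ∷ P)  {zero}  {zero}  _ = refl
enumerate-injective (inside ∷ P)  {suc i} {suc j} e =
  cong suc (enumerate-injective P (Fin-suc-injective e))
enumerate-injective (outside ∷ P) e = enumerate-injective P (Fin-suc-injective e)

enumerate-∈ : (P : Subset n) (i : Fin ∣ P ∣) → enumerate P i ∈ P
enumerate-∈ (inside ∷ P)  zero    = here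
enumerate-∈ (inside ∷ P)  (suc i) = there (enumerate-∈ P i)
enumerate-∈ (outside ∷ P) i       = there (enumerate-∈ P i)

compAdj-sym : {D : Digraph n} {x y : Fin n} → CompAdj p D x y → CompAdj p D y x
compAdj-sym (f , f-inj , common) = f , f-inj , λ i → proj₂ (common i) , proj₁ (common i)

Path-irreflexive : (x : Fin n) → ¬ Path n x x
Path-irreflexive x (inj₁ x≡1+x) = 1+n≢n (sym x≡1+x)
Path-irreflexive x (inj₂ x≡1+x) = 1+n≢n (sym x≡1+x)

module _ {n p : ℕ} (D : Digraph n) {x y : Fin n} where

  compAdj⇒commonSubset : CompAdj p D x y →
    Σ (Subset n) λ E → ∣ E ∣ ≡ p × Lift (D x) E × Lift (D y) E
  compAdj⇒commonSubset (f , f-inj , fD) = image f , ∣image∣≡ f-inj , proj₁ ∘ D-image , proj₂ ∘ D-image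
    where
    D-image : ∀ {z} → z ∈ image f → D x z × D y z
    D-image z∈ with ∈-image⁻ f z∈
    ... | i , refl = fD i

  commonSubset⇒compAdj : {E : Subset n} → p ≤ ∣ E ∣ → Lift (D x) E → Lift (D y) E → CompAdj p D x y
  commonSubset⇒compAdj {E = E} p≤∣E∣ DxE DyE =
    pick , (λ e → inject≤-injective p≤∣E∣ p≤∣E∣ _ _ (enumerate-injective E e)) ,
    λ i → DxE (enumerate-∈ E _) , DyE (enumerate-∈ E _)
    where
    pick : Fin p → Fin n
    pick i = enumerate E (inject≤ i p≤∣E∣)

  ¬compAdj⇒∣p∣+∣q∣<p+∣p∪q∣ : ¬ CompAdj p D x y → {A B : Subset n} → Lift (D x) A → Lift (D y) B →
                              ∣ A ∣ + ∣ B ∣ < p + ∣ A ∪ B ∣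
  ¬compAdj⇒∣p∣+∣q∣<p+∣p∪q∣ ¬adj {A} {B} DxA DyB = begin-strict
    ∣ A ∣ + ∣ B ∣           ≡⟨ sym (∣p∪q∣+∣p∩q∣≡∣p∣+∣q∣ A B) ⟩
    ∣ A ∪ B ∣ + ∣ A ∩ B ∣   <⟨ +-monoʳ-< ∣ A ∪ B ∣ ∣A∩B∣<p ⟩
    ∣ A ∪ B ∣ + p           ≡⟨ +-comm ∣ A ∪ B ∣ p ⟩
    p + ∣ A ∪ B ∣           ∎
    where
    open ≤-Reasoning
    ∣A∩B∣<p : ∣ A ∩ B ∣ < p
    ∣A∩B∣<p = ≰⇒> λ p≤ → ¬adj (commonSubset⇒compAdj p≤
      (λ z∈ → DxA (proj₁ (x∈p∩q⁻ A B z∈))) (λ z∈ → DyB (proj₂ (x∈p∩q⁻ A B z∈))))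

module PathRealisation {n p : ℕ} (D : Digraph n) (D-realises : IsCompGraphOf p (Path n) D) where

  private
    adjacency : ∀ {x y} → x ≢ y → Path n x y → CompAdj p D x y
    adjacency x≢y = Equivalence.to (proj₂ D-realises _ _ x≢y)

    nonadjacency : ∀ {x y} → x ≢ y → ¬ Path n x y → ¬ CompAdj p D x y
    nonadjacency x≢y ¬xy = ¬xy ∘ Equivalence.from (proj₂ D-realises _ _ x≢y)

  edgeSubset : ∀ {x y} → Path n x y → Σ (Subset n) λ E → ∣ E ∣ ≡ p × Lift (D x) E × Lift (D y) E
  edgeSubset {x} {y} xy = compAdj⇒commonSubset D (adjacency x≢y xy)
    where
    x≢y : x ≢ y
    x≢y refl = proj₁ D-realises x xy

  nonEdgeBound : ∀ {x y} → x ≢ y → ¬ Path n x y → {A B : Subset n} → Lift (D x) A → Lift (D y) B →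
                 ∣ A ∣ + ∣ B ∣ < p + ∣ A ∪ B ∣
  nonEdgeBound x≢y ¬xy = ¬compAdj⇒∣p∣+∣q∣<p+∣p∪q∣ D (nonadjacency x≢y ¬xy)

  inducedP₃Subset : ∀ {x y z} → Path n x y → Path n y z → x ≢ z → ¬ Path n x z →
                    Σ (Subset n) λ U → p < ∣ U ∣ × Lift (D y) U
  inducedP₃Subset xy yz x≢z ¬xz with edgeSubset xy | edgeSubset yz
  ... | E , ∣E∣≡p , DxE , DyE | F , ∣F∣≡p , DyF , DzF =
    E ∪ F , +-cancelˡ-< p p ∣ E ∪ F ∣ p+p<p+∣E∪F∣ , Lift-∪ DyE DyF
    where
    p+p<p+∣E∪F∣ : p + p < p + ∣ E ∪ F ∣
    p+p<p+∣E∪F∣ = subst₂ (λ a b → a + b < p + ∣ E ∪ F ∣) ∣E∣≡p ∣F∣≡p (nonEdgeBound x≢z ¬xz DxE DzF)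

module _ {n p : ℕ} where

  realisable⇒p<n : 3 ≤ n → IsCompGraph p (Path n) → p < n
  realisable⇒p<n (s≤s (s≤s (s≤s _))) (D , D-realises)
    with inducedP₃Subset {x = # 0} {# 1} {# 2} (inj₁ refl) (inj₁ refl) (λ ()) (λ { (inj₁ ()) ; (inj₂ ()) })
    where open PathRealisation D D-realises
  ... | U , p<∣U∣ , _ = <-≤-trans p<∣U∣ (∣p∣≤n U)

  realisable⇒p+2≤n : 4 ≤ n → IsCompGraph p (Path n) → p + 2 ≤ n
  realisable⇒p+2≤n (s≤s (s≤s (s≤s (s≤s _)))) (D , D-realises)
    with inducedP₃Subset {x = # 0} {# 1} {# 2} (inj₁ refl) (inj₁ refl) (λ ()) (λ { (inj₁ ()) ; (inj₂ ()) })
       | edgeSubset {# 2} {# 3} (inj₁ refl)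
    where open PathRealisation D D-realises
  ... | U , p<∣U∣ , D₁U | E , ∣E∣≡p , _ , D₃E = begin
    p + 2          ≡⟨ +-comm p 2 ⟩
    2 + p          ≤⟨ s≤s p<∣U∣ ⟩
    suc ∣ U ∣      ≤⟨ +-cancelˡ-< p ∣ U ∣ ∣ U ∪ E ∣ ∣U∣<∣U∪E∣ ⟩
    ∣ U ∪ E ∣      ≤⟨ ∣p∣≤n (U ∪ E) ⟩
    n              ∎
    where
    open ≤-Reasoning
    ∣U∣<∣U∪E∣ : p + ∣ U ∣ < p + ∣ U ∪ E ∣
    ∣U∣<∣U∪E∣ = subst (_< p + ∣ U ∪ E ∣) (trans (cong (∣ U ∣ +_) ∣E∣≡p) (+-comm ∣ U ∣ p))
      (PathRealisation.nonEdgeBound D D-realises {# 1} {# 3}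
        (λ ()) (λ { (inj₁ ()) ; (inj₂ ()) }) D₁U D₃E)

  realisable⇒p+3≤n : 5 ≤ n → IsCompGraph p (Path n) → p + 3 ≤ n
  realisable⇒p+3≤n (s≤s (s≤s (s≤s (s≤s (s≤s _))))) (D , D-realises)
    with inducedP₃Subset {x = # 0} {# 1} {# 2} (inj₁ refl) (inj₁ refl) (λ ()) (λ { (inj₁ ()) ; (inj₂ ()) })
       | inducedP₃Subset {x = # 2} {# 3} {# 4} (inj₁ refl) (inj₁ refl) (λ ()) (λ { (inj₁ ()) ; (inj₂ ()) })
    where open PathRealisation D D-realises
  ... | U , p<∣U∣ , D₁U | W , p<∣W∣ , D₃W = +-cancelˡ-≤ p (p + 3) n (begin
    p + (p + 3)          ≡⟨ cong (p +_) (+-comm p 3) ⟩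
    p + (3 + p)          ≡⟨ +-suc p (2 + p) ⟩
    suc (p + (2 + p))    ≡⟨ cong suc (+-suc p (suc p)) ⟩
    suc (suc p + suc p)  ≤⟨ s≤s (+-mono-≤ p<∣U∣ p<∣W∣) ⟩
    suc (∣ U ∣ + ∣ W ∣)   ≤⟨ PathRealisation.nonEdgeBound D D-realises {# 1} {# 3}
                              (λ ()) (λ { (inj₁ ()) ; (inj₂ ()) }) D₁U D₃W ⟩
    p + ∣ U ∪ W ∣        ≤⟨ +-monoʳ-≤ p (∣p∣≤n (U ∪ W)) ⟩
    p + n                ∎)
    where open ≤-Reasoning

subsetDigraph : (Fin n → Subset n) → Digraph n
subsetDigraph N x z = z ∈ N x

compAdj⇔p≤∣∩∣ : (N : Fin n → Subset n) {x y : Fin n} →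
                 CompAdj p (subsetDigraph N) x y ⇔ p ≤ ∣ N x ∩ N y ∣
compAdj⇔p≤∣∩∣ {p = p} N {x} {y} = mk⇔ to from
  where
  to : CompAdj p (subsetDigraph N) x y → p ≤ ∣ N x ∩ N y ∣
  to adj with compAdj⇒commonSubset (subsetDigraph N) adj
  ... | E , ∣E∣≡p , E⊆Nx , E⊆Ny =
    subst (_≤ ∣ N x ∩ N y ∣) ∣E∣≡p (p⊆q⇒∣p∣≤∣q∣ (λ z∈E → x∈p∩q⁺ (E⊆Nx z∈E , E⊆Ny z∈E)))
  from : p ≤ ∣ N x ∩ N y ∣ → CompAdj p (subsetDigraph N) x y
  from p≤ = commonSubset⇒compAdj (subsetDigraph N) p≤
    (λ z∈ → proj₁ (x∈p∩q⁻ (N x) (N y) z∈)) (λ z∈ → proj₂ (x∈p∩q⁻ (N x) (N y) z∈))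

path? : (x y : Fin n) → Dec (Path n x y)
path? x y = (toℕ y ≟ suc (toℕ x)) ⊎-dec (toℕ x ≟ suc (toℕ y))

isCompGraphOf? : {G : Graph n} → (∀ x y → Dec (G x y)) → (N : Fin n → Subset n) →
                 Dec (IsCompGraphOf p G (subsetDigraph N))
isCompGraphOf? {n} {p} {G} G? N = map′
  (λ (loopless , pairs) → loopless , λ x y x≢y → ⇔-sym (compAdj⇔p≤∣∩∣ N) ⇔-∘ pairs x y x≢y)
  (λ (loopless , pairs) → loopless , λ x y x≢y → compAdj⇔p≤∣∩∣ N ⇔-∘ pairs x y x≢y)
  (all? (λ x → ¬? (G? x x)) ×-dec
   all? λ x → all? λ y → ¬? (x ≟ᶠ y) →-dec (G? x y ⇔? (p ≤? ∣ N x ∩ N y ∣)))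
  where
  _⇔?_ : {A B : Set} → Dec A → Dec B → Dec (A ⇔ B)
  a? ⇔? b? = map′ (λ (f , g) → mk⇔ f g) (λ e → Equivalence.to e , Equivalence.from e)
    ((a? →-dec b?) ×-dec (b? →-dec a?))

interval : (n p : ℕ) → Fin n → Subset n
interval n p x = tabulate λ z → (toℕ x ≤ᵇ suc (toℕ z)) ∧ (toℕ z <ᵇ toℕ x + p)

module CyclicWindow {n p : ℕ} (1≤p : 1 ≤ p) (p+3≤n : p + 3 ≤ n) where

  private
    p<n : p < n
    p<n = <-≤-trans (m<m+n p (s≤s z≤n)) p+3≤n

    ≮n : ∀ {a b} → a ≡ b + n → ¬ a < n
    ≮n {b = b} refl lt = n≮n n (≤-<-trans (m≤n+m n b) lt)

  AddMod : ℕ → ℕ → ℕ → Set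
  AddMod u t a = a ≡ u + t ⊎ a + n ≡ u + t

  addMod-exists : ∀ {u t} → u < n → t < n → ∃ λ a → a < n × AddMod u t a
  addMod-exists {u} {t} u<n t<n with u + t <? n
  ... | yes u+t<n = u + t , u+t<n , inj₁ refl
  ... | no u+t≮n  = u + t ∸ n , wrapped<n , inj₂ (m∸n+n≡m n≤u+t)
    where
    n≤u+t : n ≤ u + t
    n≤u+t = ≮⇒≥ u+t≮n
    wrapped<n : u + t ∸ n < n
    wrapped<n = +-cancelʳ-< n (u + t ∸ n) n
      (subst (_< n + n) (sym (m∸n+n≡m n≤u+t)) (+-mono-< u<n t<n))

  addMod-offset-unique : ∀ {u t t′ a} → AddMod u t a → AddMod u t′ a → t < n → t′ < n → t ≡ t′
  addMod-offset-unique {u} (inj₁ e) (inj₁ e′) _ _ = +-cancelˡ-≡ u _ _ (trans (sym e) e′)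
  addMod-offset-unique {u} {t} (inj₁ e) (inj₂ e′) _ t′<n =
    contradiction t′<n (≮n (+-cancelˡ-≡ u _ _ (trans (sym e′) (trans (cong (_+ n) e) (+-assoc u t n)))))
  addMod-offset-unique {u} {t} {t′} (inj₂ e) (inj₁ e′) t<n _ =
    contradiction t<n (≮n (+-cancelˡ-≡ u _ _ (trans (sym e) (trans (cong (_+ n) e′) (+-assoc u t′ n)))))
  addMod-offset-unique {u} (inj₂ e) (inj₂ e′) _ _ = +-cancelˡ-≡ u _ _ (trans (sym e) e′)

  addMod-target-unique : ∀ {u t a b} → AddMod u t a → AddMod u t b → a < n → b < n → a ≡ b
  addMod-target-unique (inj₁ e) (inj₁ e′) _ _   = trans e (sym e′)
  addMod-target-unique (inj₁ e) (inj₂ e′) a<n _ = contradiction a<n (≮n (trans e (sym e′)))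
  addMod-target-unique (inj₂ e) (inj₁ e′) _ b<n = contradiction b<n (≮n (trans e′ (sym e)))
  addMod-target-unique {a = a} {b} (inj₂ e) (inj₂ e′) _ _ = +-cancelʳ-≡ n a b (trans e (sym e′))

  addMod-suc : ∀ {u t a} → AddMod u (suc t) a → AddMod (suc u) t a
  addMod-suc {u} {t} (inj₁ e) = inj₁ (trans e (+-suc u t))
  addMod-suc {u} {t} (inj₂ e) = inj₂ (trans e (+-suc u t))

  addMod-difference : ∀ {u d t s a} → AddMod u t a → AddMod (u + d) s a → t < n →
                      t ≡ d + s ⊎ t + n ≡ d + s
  addMod-difference {u} {d} {t} {s} (inj₁ e) (inj₁ e′) _ =
    inj₁ (+-cancelˡ-≡ u _ _ (trans (sym e) (trans e′ (+-assoc u d s))))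
  addMod-difference {u} {d} {t} {s} (inj₁ e) (inj₂ e′) _ =
    inj₂ (+-cancelˡ-≡ u _ _
      (trans (sym (+-assoc u t n)) (trans (cong (_+ n) (sym e)) (trans e′ (+-assoc u d s)))))
  addMod-difference {u} {d} {t} {s} (inj₂ e) (inj₁ e′) t<n =
    contradiction t<n (≮n (+-cancelˡ-≡ u _ _
      (trans (sym e) (trans (cong (_+ n) e′) (trans (cong (_+ n) (+-assoc u d s)) (+-assoc u (d + s) n))))))
  addMod-difference {u} {d} {t} {s} (inj₂ e) (inj₂ e′) _ =
    inj₁ (+-cancelˡ-≡ u _ _ (trans (sym e) (trans e′ (+-assoc u d s))))

  step : (x : Fin n) (t : ℕ) → t < n → Fin n
  step x t t<n = fromℕ< (proj₁ (proj₂ (addMod-exists (toℕ<n x) t<n)))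

  step-addMod : (x : Fin n) (t : ℕ) (t<n : t < n) → AddMod (toℕ x) t (toℕ (step x t t<n))
  step-addMod x t t<n with addMod-exists (toℕ<n x) t<n
  ... | a , a<n , addMod = subst (AddMod (toℕ x) t) (sym (toℕ-fromℕ< a<n)) addMod

  -- x points to x, x+1, …, x+p (mod n), except that the last vertex stops at x+p−1:
  -- this leaves it only p−1 out-neighbours in common with vertex 0.
  Window : Digraph n
  Window x z = ∃ λ t → AddMod (toℕ x) t (toℕ z) × t ≤ p × (suc (toℕ x) ≡ n → t < p)

  consecutive⇒compAdj : ∀ {x y} → toℕ y ≡ suc (toℕ x) → CompAdj p Window x y
  consecutive⇒compAdj {x} {y} y≡1+x = common , common-injective , λ i → x↝common i , y↝common i
    where
    1+i<n : (i : Fin p) → suc (toℕ i) < n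
    1+i<n i = ≤-trans (s≤s (toℕ<n i)) p<n
    common : Fin p → Fin n
    common i = step x (suc (toℕ i)) (1+i<n i)
    common-addMod : ∀ i → AddMod (toℕ x) (suc (toℕ i)) (toℕ (common i))
    common-addMod i = step-addMod x (suc (toℕ i)) (1+i<n i)
    common-injective : Injective _≡_ _≡_ common
    common-injective {i} {j} e = toℕ-injective (suc-injective (addMod-offset-unique (common-addMod i)
      (subst (λ z → AddMod (toℕ x) (suc (toℕ j)) (toℕ z)) (sym e) (common-addMod j)) (1+i<n i) (1+i<n j)))
    x↝common : ∀ i → Window x (common i)
    x↝common i = suc (toℕ i) , common-addMod i , toℕ<n i ,
      λ 1+x≡n → contradiction (subst (_< n) (trans y≡1+x 1+x≡n) (toℕ<n y)) (n≮n n)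
    y↝common : ∀ i → Window y (common i)
    y↝common i = toℕ i ,
      subst (λ u → AddMod u (toℕ i) (toℕ (common i))) (sym y≡1+x) (addMod-suc (common-addMod i)) ,
      <⇒≤ (toℕ<n i) , λ _ → toℕ<n i

  -- For d ≤ p + 1 this is (t − d) mod (p + 1), a bijection of {0, …, p}.
  rotate : ℕ → ℕ → ℕ
  rotate d t with d ≤? t
  ... | yes _ = t ∸ d
  ... | no _  = t + (suc p ∸ d)

  rotate-≥ : ∀ {d t} → d ≤ t → rotate d t ≡ t ∸ d
  rotate-≥ {d} {t} d≤t with d ≤? t
  ... | yes _  = refl
  ... | no d≰t = contradiction d≤t d≰t

  rotate-< : ∀ {d t} → t < d → rotate d t ≡ t + (suc p ∸ d)
  rotate-< {d} {t} t<d with d ≤? t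
  ... | yes d≤t = contradiction t<d (≤⇒≯ d≤t)
  ... | no _    = refl

  unwrapped≢wrapped : ∀ {d t t′} → d ≤ t → t ≤ p → t ∸ d ≢ t′ + (suc p ∸ d)
  unwrapped≢wrapped {d} {t} {t′} d≤t t≤p e = 1+n≰n (begin
    suc p                  ≡⟨ sym (m∸n+n≡m (≤-trans d≤t (m≤n⇒m≤1+n t≤p))) ⟩
    (suc p ∸ d) + d        ≤⟨ +-monoˡ-≤ d (m≤n+m _ t′) ⟩
    t′ + (suc p ∸ d) + d   ≡⟨ cong (_+ d) (sym e) ⟩
    t ∸ d + d              ≡⟨ m∸n+n≡m d≤t ⟩
    t                      ≤⟨ t≤p ⟩
    p                      ∎)
    where open ≤-Reasoning

  rotate-injective : ∀ d {t t′} → t ≤ p → t′ ≤ p → rotate d t ≡ rotate d t′ → t ≡ t′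
  rotate-injective d {t} {t′} t≤p t′≤p e with d ≤? t | d ≤? t′
  ... | yes d≤t | yes d≤t′ = trans (sym (m∸n+n≡m d≤t)) (trans (cong (_+ d) e) (m∸n+n≡m d≤t′))
  ... | no _    | no _     = +-cancelʳ-≡ _ t t′ e
  ... | yes d≤t | no _     = ⊥-elim (unwrapped≢wrapped d≤t t≤p e)
  ... | no _    | yes d≤t′ = ⊥-elim (unwrapped≢wrapped d≤t′ t′≤p (sym e))

  rotate-bound-unwrapped : ∀ {d t s} → 2 ≤ d → t ≤ p → t ≡ d + s → 2 + rotate d t ≤ p
  rotate-bound-unwrapped {d} {t} {s} 2≤d t≤p t≡d+s = begin
    2 + rotate d t  ≡⟨ cong (2 +_) (trans (rotate-≥ d≤t) (trans (cong (_∸ d) t≡d+s) (m+n∸m≡n d s))) ⟩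
    2 + s           ≤⟨ +-monoˡ-≤ s 2≤d ⟩
    d + s           ≡⟨ sym t≡d+s ⟩
    t               ≤⟨ t≤p ⟩
    p               ∎
    where
    open ≤-Reasoning
    d≤t : d ≤ t
    d≤t = subst (d ≤_) (sym t≡d+s) (m≤m+n d s)

  -- The only place where the shortened window of the last vertex is needed.
  2+v+s≤n+p : ∀ {v s} → v < n → s ≤ p → (suc v ≡ n → s < p) → 2 + (v + s) ≤ n + p
  2+v+s≤n+p {v} {s} v<n s≤p last⇒s<p with suc v ≟ n
  ... | yes 1+v≡n = subst (_≤ n + p) (cong suc (+-suc v s)) (+-mono-≤ (≤-reflexive 1+v≡n) (last⇒s<p 1+v≡n))
  ... | no 1+v≢n  = +-mono-≤ (≤∧≢⇒< v<n 1+v≢n) s≤p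

  wrapped⇒< : ∀ {d t s} → s ≤ p → t + n ≡ d + s → t < d
  wrapped⇒< {d} {t} {s} s≤p t+n≡d+s =
    +-cancelʳ-< n t d (subst (_< d + n) (sym t+n≡d+s) (+-monoʳ-< d (≤-<-trans s≤p p<n)))

  rotate-bound-wrapped : ∀ {d v t s} → d ≤ v → v < n → s ≤ p → (suc v ≡ n → s < p) →
                         t + n ≡ d + s → 2 + rotate d t ≤ p
  rotate-bound-wrapped {d} {v} {t} {s} d≤v v<n s≤p last⇒s<p t+n≡d+s with d ≤? suc p
  ... | yes d≤1+p = ≤-pred (begin
    3 + rotate d t             ≡⟨ cong (3 +_) (rotate-< (wrapped⇒< s≤p t+n≡d+s)) ⟩
    3 + (t + (suc p ∸ d))      ≡⟨ sym (+-assoc 3 t _) ⟩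
    3 + t + (suc p ∸ d)        ≤⟨ +-monoˡ-≤ (suc p ∸ d) (subst (_≤ d) (+-comm t 3) t+3≤d) ⟩
    d + (suc p ∸ d)            ≡⟨ m+[n∸m]≡n d≤1+p ⟩
    suc p                      ∎)
    where
    open ≤-Reasoning
    t+3≤d : t + 3 ≤ d
    t+3≤d = +-cancelʳ-≤ p (t + 3) d (begin
      t + 3 + p    ≡⟨ +-assoc t 3 p ⟩
      t + (3 + p)  ≡⟨ cong (t +_) (+-comm 3 p) ⟩
      t + (p + 3)  ≤⟨ +-monoʳ-≤ t p+3≤n ⟩
      t + n        ≡⟨ t+n≡d+s ⟩
      d + s        ≤⟨ +-monoʳ-≤ d s≤p ⟩
      d + p        ∎)
  ... | no d≰1+p = +-cancelʳ-≤ n (2 + rotate d t) p (begin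
    2 + rotate d t + n         ≡⟨ cong (λ r → 2 + r + n) (rotate-< (wrapped⇒< s≤p t+n≡d+s)) ⟩
    2 + (t + (suc p ∸ d)) + n  ≡⟨ cong (λ k → 2 + (t + k) + n) 1+p∸d≡0 ⟩
    2 + (t + 0) + n            ≡⟨ cong (λ r → 2 + (r + n)) (+-identityʳ t) ⟩
    2 + (t + n)                ≡⟨ cong (2 +_) t+n≡d+s ⟩
    2 + (d + s)                ≤⟨ +-monoʳ-≤ 2 (+-monoˡ-≤ s d≤v) ⟩
    2 + (v + s)                ≤⟨ 2+v+s≤n+p v<n s≤p last⇒s<p ⟩
    n + p                      ≡⟨ +-comm n p ⟩
    p + n                      ∎)
    where
    open ≤-Reasoning
    1+p∸d≡0 : suc p ∸ d ≡ 0
    1+p∸d≡0 = m≤n⇒m∸n≡0 (<⇒≤ (≰⇒> d≰1+p))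

  rank-bound : ∀ {x y z d} → toℕ x + d ≡ toℕ y → 2 ≤ d → (x↝z : Window x z) → Window y z →
               2 + rotate d (proj₁ x↝z) ≤ p
  rank-bound {x} {y} {z} {d} x+d≡y 2≤d (t , x+t≡z , t≤p , _) (s , y+s≡z , s≤p , last⇒s<p)
    with addMod-difference x+t≡z (subst (λ v → AddMod v s (toℕ z)) (sym x+d≡y) y+s≡z) (≤-<-trans t≤p p<n)
  ... | inj₁ t≡d+s   = rotate-bound-unwrapped 2≤d t≤p t≡d+s
  ... | inj₂ t+n≡d+s = rotate-bound-wrapped (subst (d ≤_) x+d≡y (m≤n+m d _)) (toℕ<n y) s≤p last⇒s<p t+n≡d+s

  distant⇒¬compAdj : ∀ {x y d} → toℕ x + d ≡ toℕ y → 2 ≤ d → ¬ CompAdj p Window x y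
  distant⇒¬compAdj {x} {y} {d} x+d≡y 2≤d (f , f-inj , common) = p≰pred[p] (injective⇒≤ rank-injective)
    where
    p≰pred[p] : ¬ p ≤ pred p
    p≰pred[p] p≤pred[p] = 1+n≰n (subst (_≤ pred p) (sym (suc-pred p {{>-nonZero 1≤p}})) p≤pred[p])
    x↝f : ∀ i → Window x (f i)
    x↝f i = proj₁ (common i)
    rank : Fin p → Fin (pred p)
    rank i = fromℕ< (suc[m]≤n⇒m≤pred[n] (rank-bound x+d≡y 2≤d (x↝f i) (proj₂ (common i))))
    rank-injective : Injective _≡_ _≡_ rank
    rank-injective {i} {j} e = f-inj (toℕ-injective (addMod-target-unique {toℕ x}
      (proj₁ (proj₂ (x↝f i)))
      (subst (λ t → AddMod (toℕ x) t (toℕ (f j))) (sym offsets≡) (proj₁ (proj₂ (x↝f j))))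
      (toℕ<n (f i)) (toℕ<n (f j))))
      where
      offsets≡ : proj₁ (x↝f i) ≡ proj₁ (x↝f j)
      offsets≡ = rotate-injective d (proj₁ (proj₂ (proj₂ (x↝f i)))) (proj₁ (proj₂ (proj₂ (x↝f j))))
        (trans (sym (toℕ-fromℕ< _)) (trans (cong toℕ e) (toℕ-fromℕ< _)))

  compAdj⇒consecutive : ∀ {x y} → toℕ x < toℕ y → CompAdj p Window x y → toℕ y ≡ suc (toℕ x)
  compAdj⇒consecutive {x} {y} x<y adj with m≤n⇒∃[o]m+o≡n x<y
  ... | zero , 1+x+0≡y = trans (sym 1+x+0≡y) (cong suc (+-identityʳ (toℕ x)))
  ... | suc o , 1+x+1+o≡y =
    contradiction adj (distant⇒¬compAdj (trans (+-suc (toℕ x) (suc o)) 1+x+1+o≡y) (s≤s (s≤s z≤n)))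

  Window-realises : IsCompGraphOf p (Path n) Window
  Window-realises = Path-irreflexive , λ x y x≢y → mk⇔ path⇒compAdj (compAdj⇒path x≢y)
    where
    path⇒compAdj : ∀ {x y} → Path n x y → CompAdj p Window x y
    path⇒compAdj (inj₁ y≡1+x) = consecutive⇒compAdj y≡1+x
    path⇒compAdj (inj₂ x≡1+y) = compAdj-sym {D = Window} (consecutive⇒compAdj x≡1+y)
    compAdj⇒path : ∀ {x y} → x ≢ y → CompAdj p Window x y → Path n x y
    compAdj⇒path {x} {y} x≢y adj with <-cmp (toℕ x) (toℕ y)
    ... | tri< x<y _ _ = inj₁ (compAdj⇒consecutive x<y adj)
    ... | tri≈ _ x≡y _ = contradiction (toℕ-injective x≡y) x≢y
    ... | tri> _ _ y<x = inj₂ (compAdj⇒consecutive y<x (compAdj-sym {D = Window} adj))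

realisedByIntervals : (n p : ℕ) → {True (isCompGraphOf? {p = p} path? (interval n p))} →
                      IsCompGraph p (Path n)
realisedByIntervals n p {ok} = subsetDigraph (interval n p) , toWitness ok

1≤p≤2 : 1 ≤ p → p ≤ 2 → p ≡ 1 ⊎ p ≡ 2
1≤p≤2 (s≤s z≤n) (s≤s z≤n)       = inj₁ refl
1≤p≤2 (s≤s z≤n) (s≤s (s≤s z≤n)) = inj₂ refl

mainTheorem10 : (n : ℕ) → 3 ≤ n →
    ((n ≡ 3 ⊎ n ≡ 4) → ∀ p → (InUpsilon (Path n) p ⇔ (p ≡ 1 ⊎ p ≡ 2)))
    × (5 ≤ n → ∀ p → (InUpsilon (Path n) p ⇔ (1 ≤ p × p ≤ n ∸ 3)))
mainTheorem10 n 3≤n = small , large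
  where
  small : (n ≡ 3 ⊎ n ≡ 4) → ∀ p → InUpsilon (Path n) p ⇔ (p ≡ 1 ⊎ p ≡ 2)
  small (inj₁ refl) p = mk⇔
    (λ ((1≤p , _) , realisable) → 1≤p≤2 1≤p (≤-pred (realisable⇒p<n 3≤n realisable)))
    λ { (inj₁ refl) → (s≤s z≤n , s≤s z≤n) , realisedByIntervals 3 1
      ; (inj₂ refl) → (s≤s z≤n , s≤s (s≤s z≤n)) , realisedByIntervals 3 2 }
  small (inj₂ refl) p = mk⇔
    (λ ((1≤p , _) , realisable) → 1≤p≤2 1≤p (+-cancelʳ-≤ 2 p 2 (realisable⇒p+2≤n ≤-refl realisable)))
    λ { (inj₁ refl) → (s≤s z≤n , s≤s z≤n) , realisedByIntervals 4 1
      ; (inj₂ refl) → (s≤s z≤n , s≤s (s≤s z≤n)) , realisedByIntervals 4 2 }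
  large : 5 ≤ n → ∀ p → InUpsilon (Path n) p ⇔ (1 ≤ p × p ≤ n ∸ 3)
  large 5≤n p = mk⇔
    (λ ((1≤p , _) , realisable) → 1≤p , m+n≤o⇒m≤o∸n p (realisable⇒p+3≤n 5≤n realisable))
    λ (1≤p , p≤n∸3) → let p+3≤n = m≤o∸n⇒m+n≤o p (≤-trans (s≤s (s≤s (s≤s z≤n))) 5≤n) p≤n∸3
                          open CyclicWindow 1≤p p+3≤n in
      (1≤p , ≤-trans (m≤m+n p 3) p+3≤n) , Window , Window-realises
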